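{- For every $n\geq 0$ and every $v\in\{a,b\}^n$, $$\pi(\psi(v))\leq\pi(\psi(v^{(n)}))=F_{n-1},$$ and the maximum is reached (i.e. $\pi(\psi(v))=F_{n-1}$) if and only if $v$ is one of the words $v^{(n)}$, $E(v^{(n)})$, $c(v^{(n)})$, $E(c(v^{(n)}))$.
   Context: Let $\mathcal{A}=\{a,b\}$. For $w\in\mathcal{A}^*$, $w^{(+)}$ is the shortest palindrome having $w$ as a prefix; $\psi(\varepsilon)=\varepsilon$, $\psi(vx)=(\psi(v)x)^{(+)}$ ($v\in\mathcal{A}^*$, $x\in\mathcal{A}$). $\pi(w)$ denotes the minimal period of a word $w$ (the least $p\geq1$ with $w_i=w_j$ whenever $i\equiv j\pmod p$), with the convention $\pi(\varepsilon)=1$. $v^{(n)}$ is the prefix of length $n$ of $(ab)^\omega$. $E$ is the automorphism of $\mathcal{A}^*$ exchanging $a$ and $b$. The operator $c$ on $\mathcal{A}^*$ is defined by $c(\varepsilon)=\varepsilon$, $c(x)=x$ for $x\in\mathcal{A}$, and $c(uxy)=uyx$ for $u\in\mathcal{A}^*$, $x,y\in\mathcal{A}$ (it swaps the last two letters). Fibonacci numbers: $F_{ -1}=F_0=1$, $F_{n+1}=F_n+F_{n-1}$. -}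

module Defs where

open import Data.Nat using (ℕ; zero; suc; _+_; _∸_; _⊔_)
open import Data.Bool using (Bool; true; false; _∧_; if_then_else_)
open import Data.List using (List; []; _∷_; _++_; reverse; take; length; map; upTo)
open import Data.Maybe using (Maybe; just; nothing)

data Letter : Set where
  a b : Letter

Word : Set
Word = List Letter

_==L_ : Letter → Letter → Bool
a ==L a = true
b ==L b = true
_ ==L _ = false

_==W_ : Word → Word → Bool
[] ==W [] = true
(x ∷ u) ==W (y ∷ v) = (x ==L y) ∧ (u ==W v)
_ ==W _ = false

isPalᵇ : Word → Bool
isPalᵇ w = w ==W reverse w

-- w^(+): shortest palindrome having w as prefix.  A word of length |w|+k
-- with prefix w is w ++ x, |x| = k; it is a palindrome only if
-- x = reverse (take k w) (for k ≤ |w|), and k = |w| always works.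
palSearch : Word → ℕ → ℕ → Word
palSearch w k zero = w ++ reverse w
palSearch w k (suc fuel) =
  if isPalᵇ (w ++ reverse (take k w)) then w ++ reverse (take k w)
  else palSearch w (suc k) fuel

palClosure : Word → Word
palClosure w = palSearch w 0 (length w)

-- ψ(ε) = ε, ψ(vx) = (ψ(v)x)^(+); we process the list left to right
-- via an accumulator.
ψ-acc : Word → Word → Word
ψ-acc acc [] = acc
ψ-acc acc (x ∷ v) = ψ-acc (palClosure (acc ++ x ∷ [])) v

ψ : Word → Word
ψ v = ψ-acc [] v

allᵇ : {A : Set} → (A → Bool) → List A → Bool
allᵇ f [] = true
allᵇ f (x ∷ xs) = f x ∧ allᵇ f xs

at : Word → ℕ → Maybe Letter
at [] _ = nothing
at (x ∷ w) zero = just x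
at (x ∷ w) (suc i) = at w i

_==M_ : Maybe Letter → Maybe Letter → Bool
just x ==M just y = x ==L y
nothing ==M nothing = true
_ ==M _ = false

hasPeriodᵇ : ℕ → Word → Bool
hasPeriodᵇ p w = allᵇ (λ i → at w i ==M at w (i + p)) (upTo (length w ∸ p))

periodSearch : Word → ℕ → ℕ → ℕ
periodSearch w p zero = p
periodSearch w p (suc fuel) =
  if hasPeriodᵇ p w then p else periodSearch w (suc p) fuel

-- π(w): least p ≥ 1 that is a period of w (π(ε) = 1).
-- Searching p = 1, 2, ..., max(1,|w|) suffices since |w| is a period.
π : Word → ℕ
π w = periodSearch w 1 (length w)

altFrom : Letter → ℕ → Word
altFrom x zero = []
altFrom a (suc n) = a ∷ altFrom b n
altFrom b (suc n) = b ∷ altFrom a n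

vpow : ℕ → Word
vpow n = altFrom a n

swapL : Letter → Letter
swapL a = b
swapL b = a

E : Word → Word
E = map swapL

c : Word → Word
c [] = []
c (x ∷ []) = x ∷ []
c (x ∷ y ∷ []) = y ∷ x ∷ []
c (x ∷ y ∷ z ∷ w) = x ∷ c (y ∷ z ∷ w)

-- Fm1 n = F_{n-1}, with F_{-1} = F_0 = 1, F_{k+1} = F_k + F_{k-1}
Fm1 : ℕ → ℕ
Fm1 zero = 1
Fm1 (suc zero) = 1
Fm1 (suc (suc n)) = Fm1 (suc n) + Fm1 n

module Submission where

-- Plan of the file.
--  * Reflection of the boolean tests of Defs (palindromes, periods, π).
--  * The shape of one closure step: (w)^(+) = w · reverse(take j w) where j is
--    the least cut with drop j w a palindrome; consequences for ψ: ψ(v) is a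
--    palindrome, ψ(u) is a prefix of ψ(uw), and every palindromic prefix of
--    ψ(v) is ψ(u) for a prefix u of v.
--  * Justin-type length formula: |ψ(vx)| = |ψ(v)| + g, where the gap g of x in
--    v is |ψ(v)| − |ψ(v₁)| for the last occurrence v = v₁xv₂ of x (|ψ(v)|+1 if
--    x does not occur); each gap is a period of ψ(v).
--  * The two gaps (g_a, g_b) evolve like a Euclid/Fibonacci pair: they are
--    coprime and g_a + g_b = |ψ(v)| + 2.  By the Fine–Wilf theorem the smaller
--    gap is then a lower bound for π(ψ(v)) (when ψ(v) is not constant), and it
--    is always an upper bound.
--  * An optimisation over the letter sequence shows the smaller gap is at most
--    F_{n-1}, with equality exactly for the four extremal words.

open import Defs
open import Data.Nat using (ℕ; zero; suc; _+_; _*_; _∸_; _≤_; _<_; z≤n; s≤s; s≤s⁻¹; _≟_; _≤?_; _<?_; >-nonZero)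
open import Data.Nat.Properties
open import Data.Nat.Induction using (<-rec)
open import Algebra.Properties.CommutativeSemigroup +-commutativeSemigroup using () renaming (xy∙z≈xz∙y to +-right-comm)
open import Data.Nat.Divisibility using (_∣_; divides; ∣-refl; ∣-trans; ∣⇒≤; ∣m∸n∣n⇒∣m)
open import Data.Nat.Coprimality using (Coprime; 1-coprimeTo; coprime-+) renaming (sym to coprime-sym)
open import Data.Bool using (Bool; true; false; _∧_)
open import Data.List using ([]; _∷_; _++_; reverse; take; drop; length; foldl; applyUpTo)
open import Data.List.Properties
open import Data.Maybe using (just; nothing)
open import Data.Maybe.Properties using (just-injective)
open import Data.Product using (∃; _×_; _,_; proj₁; proj₂)
open import Data.Sum using (_⊎_; inj₁; inj₂)
open import Data.List.Membership.Propositional using (_∈_; _∉_)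
open import Data.List.Membership.Propositional.Properties using (∈-++⁻; ∈-insert)
open import Data.List.Relation.Unary.Any using (here)
open import Data.Empty using (⊥; ⊥-elim)
open import Relation.Nullary using (¬_; yes; no)
open import Relation.Binary using (tri<; tri≈; tri>)
open import Relation.Binary.PropositionalEquality
open import Function.Bundles using (_⇔_; mk⇔; Equivalence)

∧-true : ∀ {x y} → x ∧ y ≡ true → x ≡ true × y ≡ true
∧-true {true} {true} refl = refl , refl
∧-true {true} {false} ()
∧-true {false} ()

==L-sound : ∀ x y → (x ==L y) ≡ true → x ≡ y
==L-sound a a _ = refl
==L-sound b b _ = refl
==L-sound a b ()
==L-sound b a ()

==L-refl : ∀ x → (x ==L x) ≡ true
==L-refl a = refl
==L-refl b = refl

==W-sound : ∀ u v → (u ==W v) ≡ true → u ≡ v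
==W-sound [] [] _ = refl
==W-sound (x ∷ u) (y ∷ v) e with ∧-true {x ==L y} e
... | e₁ , e₂ = cong₂ _∷_ (==L-sound x y e₁) (==W-sound u v e₂)
==W-sound [] (_ ∷ _) ()
==W-sound (_ ∷ _) [] ()

==W-refl : ∀ u → (u ==W u) ≡ true
==W-refl [] = refl
==W-refl (x ∷ u) rewrite ==L-refl x = ==W-refl u

==M-sound : ∀ u v → (u ==M v) ≡ true → u ≡ v
==M-sound (just x) (just y) e = cong just (==L-sound x y e)
==M-sound nothing nothing _ = refl
==M-sound (just _) nothing ()
==M-sound nothing (just _) ()

==M-refl : ∀ u → (u ==M u) ≡ true
==M-refl (just x) = ==L-refl x
==M-refl nothing = refl

Pal : Word → Set
Pal w = reverse w ≡ w

isPal-sound : ∀ w → isPalᵇ w ≡ true → Pal w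
isPal-sound w e = sym (==W-sound w (reverse w) e)

isPal-complete : ∀ w → Pal w → isPalᵇ w ≡ true
isPal-complete w p = subst (λ z → (w ==W z) ≡ true) (sym p) (==W-refl w)

isPal-false : ∀ w → isPalᵇ w ≡ false → ¬ Pal w
isPal-false w e p with trans (sym (isPal-complete w p)) e
... | ()

Period : ℕ → Word → Set
Period p w = ∀ i → i + p < length w → at w i ≡ at w (i + p)

<∸⇒+< : ∀ i n p → i < n ∸ p → i + p < n
<∸⇒+< i n zero lt rewrite +-identityʳ i = lt
<∸⇒+< i (suc n) (suc p) lt rewrite +-suc i p = s≤s (<∸⇒+< i n p lt)

long-period : ∀ p w → length w ≤ p → Period p w
long-period p w le i lt = ⊥-elim (<-irrefl refl (≤-<-trans (≤-trans le (m≤n+m p i)) lt))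

allᵇ-applyUpTo⁻ : ∀ (f : ℕ → Bool) g n → allᵇ f (applyUpTo g n) ≡ true → ∀ i → i < n → f (g i) ≡ true
allᵇ-applyUpTo⁻ f g (suc n) e zero _ = proj₁ (∧-true {f (g 0)} e)
allᵇ-applyUpTo⁻ f g (suc n) e (suc i) (s≤s i<n) =
  allᵇ-applyUpTo⁻ f (λ k → g (suc k)) n (proj₂ (∧-true {f (g 0)} e)) i i<n

allᵇ-applyUpTo⁺ : ∀ (f : ℕ → Bool) g n → (∀ i → i < n → f (g i) ≡ true) → allᵇ f (applyUpTo g n) ≡ true
allᵇ-applyUpTo⁺ f g zero h = refl
allᵇ-applyUpTo⁺ f g (suc n) h rewrite h 0 (s≤s z≤n) =
  allᵇ-applyUpTo⁺ f (λ k → g (suc k)) n (λ i i<n → h (suc i) (s≤s i<n))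

hasPeriod-sound : ∀ p w → hasPeriodᵇ p w ≡ true → Period p w
hasPeriod-sound p w e i lt = ==M-sound _ _ (allᵇ-applyUpTo⁻ _ (λ k → k) (length w ∸ p) e i
  (subst (_< length w ∸ p) (m+n∸n≡m i p) (∸-monoˡ-< lt (m≤n+m p i))))

hasPeriod-complete : ∀ p w → Period p w → hasPeriodᵇ p w ≡ true
hasPeriod-complete p w h = allᵇ-applyUpTo⁺ _ (λ k → k) (length w ∸ p) λ i lt →
  subst (λ z → (at w i ==M z) ≡ true) (h i (<∸⇒+< i (length w) p lt)) (==M-refl (at w i))

periodSearch-least : ∀ w p f r → Period r w → p ≤ r → periodSearch w p f ≤ r
periodSearch-least w p zero r h le = le
periodSearch-least w p (suc f) r h le with hasPeriodᵇ p w in eq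
... | true = le
... | false with p ≟ r
...   | yes refl with trans (sym eq) (hasPeriod-complete p w h)
...     | ()
periodSearch-least w p (suc f) r h le | false | no p≢r = periodSearch-least w (suc p) f r h (≤∧≢⇒< le p≢r)

periodSearch-period : ∀ w p f → length w ≤ p + f → Period (periodSearch w p f) w
periodSearch-period w p zero le = long-period p w (subst (length w ≤_) (+-identityʳ p) le)
periodSearch-period w p (suc f) le with hasPeriodᵇ p w in eq
... | true = hasPeriod-sound p w eq
... | false = periodSearch-period w (suc p) f (subst (length w ≤_) (+-suc p f) le)

periodSearch-≥ : ∀ w p f → p ≤ periodSearch w p f
periodSearch-≥ w p zero = ≤-refl
periodSearch-≥ w p (suc f) with hasPeriodᵇ p w
... | true = ≤-refl
... | false = ≤-trans (n≤1+n p) (periodSearch-≥ w (suc p) f)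

π-least : ∀ w r → 1 ≤ r → Period r w → π w ≤ r
π-least w r le h = periodSearch-least w 1 (length w) r h le

π-positive : ∀ w → 1 ≤ π w
π-positive w = periodSearch-≥ w 1 (length w)

π-period : ∀ w → Period (π w) w
π-period w = periodSearch-period w 1 (length w) (n≤1+n (length w))

take-length-++ : ∀ (xs ys : Word) → take (length xs) (xs ++ ys) ≡ xs
take-length-++ [] ys = refl
take-length-++ (x ∷ xs) ys = cong (x ∷_) (take-length-++ xs ys)

take-++ˡ : ∀ n (xs ys : Word) → n ≤ length xs → take n (xs ++ ys) ≡ take n xs
take-++ˡ zero xs ys _ = refl
take-++ˡ (suc n) (x ∷ xs) ys (s≤s le) = cong (x ∷_) (take-++ˡ n xs ys le)

drop-length-++ : ∀ (xs ys : Word) → drop (length xs) (xs ++ ys) ≡ ys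
drop-length-++ [] ys = refl
drop-length-++ (x ∷ xs) ys = drop-length-++ xs ys

length-take-≤ : ∀ n (xs : Word) → n ≤ length xs → length (take n xs) ≡ n
length-take-≤ n xs le = trans (length-take n xs) (m≤n⇒m⊓n≡m le)

++-split : ∀ (xs ys zs ws : Word) → xs ++ ys ≡ zs ++ ws →
  (∃ λ r → zs ≡ xs ++ r × ys ≡ r ++ ws) ⊎ (∃ λ r → xs ≡ zs ++ r × ws ≡ r ++ ys)
++-split [] ys zs ws e = inj₁ (zs , refl , e)
++-split (x ∷ xs) ys [] ws e = inj₂ (x ∷ xs , refl , sym e)
++-split (x ∷ xs) ys (z ∷ zs) ws e with ∷-injective e
... | refl , e' with ++-split xs ys zs ws e'
...   | inj₁ (r , e₁ , e₂) = inj₁ (r , cong (x ∷_) e₁ , e₂)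
...   | inj₂ (r , e₁ , e₂) = inj₂ (r , cong (x ∷_) e₁ , e₂)

split-at : ∀ (w : Word) l → l < length w → ∃ λ A → ∃ λ y → ∃ λ B → w ≡ A ++ y ∷ B × length A ≡ l
split-at (y ∷ w) zero _ = [] , y , w , refl , refl
split-at (z ∷ w) (suc l) (s≤s lt) with split-at w l lt
... | A , y , B , e , el = z ∷ A , y , B , cong (z ∷_) e , cong suc el

at-++ˡ : ∀ (xs ys : Word) i → i < length xs → at (xs ++ ys) i ≡ at xs i
at-++ˡ (x ∷ xs) ys zero _ = refl
at-++ˡ (x ∷ xs) ys (suc i) (s≤s lt) = at-++ˡ xs ys i lt

at-++ʳ : ∀ (xs ys : Word) i → at (xs ++ ys) (length xs + i) ≡ at ys i
at-++ʳ [] ys i = refl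
at-++ʳ (x ∷ xs) ys i = at-++ʳ xs ys i

at-take : ∀ n (w : Word) i → i < n → at (take n w) i ≡ at w i
at-take (suc n) [] i _ = refl
at-take (suc n) (x ∷ w) zero _ = refl
at-take (suc n) (x ∷ w) (suc i) (s≤s lt) = at-take n w i lt

reverse-mid : ∀ (A : Word) y B → reverse (A ++ y ∷ B) ≡ reverse B ++ y ∷ reverse A
reverse-mid A y B = begin
  reverse (A ++ y ∷ B)          ≡⟨ reverse-++ A (y ∷ B) ⟩
  reverse (y ∷ B) ++ reverse A  ≡⟨ cong (_++ reverse A) (unfold-reverse y B) ⟩
  (reverse B ++ y ∷ []) ++ reverse A ≡⟨ ++-assoc (reverse B) (y ∷ []) (reverse A) ⟩
  reverse B ++ y ∷ reverse A    ∎
  where open ≡-Reasoning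

reverse-ends : ∀ y (B : Word) x → reverse (y ∷ B ++ x ∷ []) ≡ x ∷ reverse B ++ y ∷ []
reverse-ends y B x = begin
  reverse (y ∷ B ++ x ∷ [])       ≡⟨ unfold-reverse y (B ++ x ∷ []) ⟩
  reverse (B ++ x ∷ []) ++ y ∷ [] ≡⟨ cong (_++ y ∷ []) (reverse-++ B (x ∷ [])) ⟩
  x ∷ reverse B ++ y ∷ []         ∎
  where open ≡-Reasoning

sandwich : ∀ (t d : Word) → reverse (t ++ d ++ reverse t) ≡ t ++ reverse d ++ reverse t
sandwich t d = begin
  reverse (t ++ d ++ reverse t)                   ≡⟨ reverse-++ t (d ++ reverse t) ⟩
  reverse (d ++ reverse t) ++ reverse t           ≡⟨ cong (_++ reverse t) (reverse-++ d (reverse t)) ⟩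
  (reverse (reverse t) ++ reverse d) ++ reverse t ≡⟨ cong (λ z → (z ++ reverse d) ++ reverse t) (reverse-involutive t) ⟩
  (t ++ reverse d) ++ reverse t                   ≡⟨ ++-assoc t (reverse d) (reverse t) ⟩
  t ++ reverse d ++ reverse t                     ∎
  where open ≡-Reasoning

sandwich⁻ : ∀ (t d : Word) → Pal (t ++ d ++ reverse t) → Pal d
sandwich⁻ t d p = ++-cancelʳ (reverse t) (reverse d) d (++-cancelˡ t _ _ (trans (sym (sandwich t d)) p))

sandwich⁺ : ∀ (t d : Word) → Pal d → Pal (t ++ d ++ reverse t)
sandwich⁺ t d p = trans (sandwich t d) (cong (λ z → t ++ z ++ reverse t) p)

close-eq : ∀ k (w : Word) → w ++ reverse (take k w) ≡ take k w ++ drop k w ++ reverse (take k w)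
close-eq k w = trans (cong (_++ reverse (take k w)) (sym (take++drop≡id k w))) (++-assoc (take k w) (drop k w) _)

close⁻ : ∀ k (w : Word) → Pal (w ++ reverse (take k w)) → Pal (drop k w)
close⁻ k w p = sandwich⁻ (take k w) (drop k w) (subst Pal (close-eq k w) p)

close⁺ : ∀ k (w : Word) → Pal (drop k w) → Pal (w ++ reverse (take k w))
close⁺ k w p = subst Pal (sym (close-eq k w)) (sandwich⁺ (take k w) (drop k w) p)

-- The right palindromic closure w^(+) is w closed at the least cut whose
-- suffix is a palindrome (the longest palindromic suffix).
record Closure (w : Word) : Set where
  field
    cut       : ℕ
    cut≤      : cut ≤ length w
    palSuffix : Pal (drop cut w)
    leastCut  : ∀ l → l < cut → ¬ Pal (drop l w)
    closure≡  : palClosure w ≡ w ++ reverse (take cut w)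

palSearch-spec : ∀ w k f → k + f ≡ length w → (∀ l → l < k → ¬ Pal (drop l w)) →
  ∃ λ j → j ≤ length w × Pal (drop j w) × (∀ l → l < j → ¬ Pal (drop l w)) × palSearch w k f ≡ w ++ reverse (take j w)
palSearch-spec w k zero e h = length w , ≤-refl , subst Pal (sym (drop-all (length w) w ≤-refl)) refl , h' ,
  cong (λ z → w ++ reverse z) (sym (take-all (length w) w ≤-refl))
  where
  h' : ∀ l → l < length w → ¬ Pal (drop l w)
  h' l lt = h l (subst (l <_) (trans (sym e) (+-identityʳ k)) lt)
palSearch-spec w k (suc f) e h with isPalᵇ (w ++ reverse (take k w)) in eq
... | true = k , subst (k ≤_) e (m≤m+n k (suc f)) , close⁻ k w (isPal-sound _ eq) , h , refl
... | false = palSearch-spec w (suc k) f (trans (sym (+-suc k f)) e) h'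
  where
  h' : ∀ l → l < suc k → ¬ Pal (drop l w)
  h' l lt with l ≟ k
  ... | yes refl = λ p → isPal-false _ eq (close⁺ k w p)
  ... | no l≢k = h l (≤∧≢⇒< (s≤s⁻¹ lt) l≢k)

closure : ∀ w → Closure w
closure w with palSearch-spec w 0 (length w) refl (λ l ())
... | j , le , p , m , e = record { cut = j ; cut≤ = le ; palSuffix = p ; leastCut = m ; closure≡ = e }

cut-unique : ∀ w k → Pal (drop k w) → (∀ l → l < k → ¬ Pal (drop l w)) → Closure.cut (closure w) ≡ k
cut-unique w k p h with <-cmp (Closure.cut (closure w)) k
... | tri< lt _ _ = ⊥-elim (h _ lt (Closure.palSuffix (closure w)))
... | tri≈ _ e _ = e
... | tri> _ _ gt = ⊥-elim (Closure.leastCut (closure w) k gt p)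

pal-tail : ∀ (P W t : Word) → Pal P → P ≡ W ++ t → length t ≤ length W → t ≡ reverse (take (length t) W)
pal-tail P W t p e le = trans (sym (reverse-involutive t)) (cong reverse rt)
  where
  e₂ : reverse t ++ reverse W ≡ W ++ t
  e₂ = trans (sym (reverse-++ W t)) (trans (cong reverse (sym e)) (trans p e))
  rt : reverse t ≡ take (length t) W
  rt = begin
    reverse t                                        ≡⟨ sym (take-length-++ (reverse t) (reverse W)) ⟩
    take (length (reverse t)) (reverse t ++ reverse W) ≡⟨ cong₂ take (length-reverse t) e₂ ⟩
    take (length t) (W ++ t)                         ≡⟨ take-++ˡ (length t) W t le ⟩
    take (length t) W                                ∎
    where open ≡-Reasoning

ψ-acc-++ : ∀ acc u v → ψ-acc acc (u ++ v) ≡ ψ-acc (ψ-acc acc u) v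
ψ-acc-++ acc [] v = refl
ψ-acc-++ acc (x ∷ u) v = ψ-acc-++ _ u v

ψ-snoc : ∀ v x → ψ (v ++ x ∷ []) ≡ palClosure (ψ v ++ x ∷ [])
ψ-snoc v x = ψ-acc-++ [] v (x ∷ [])

snoc-induction : (Q : Word → Set) → Q [] → (∀ v x → Q v → Q (v ++ x ∷ [])) → ∀ v → Q v
snoc-induction Q q₀ qs v = subst Q (reverse-involutive v) (go (reverse v))
  where
  go : ∀ r → Q (reverse r)
  go [] = q₀
  go (x ∷ r) = subst Q (sym (unfold-reverse x r)) (qs (reverse r) x (go r))

stepCut : Word → Letter → ℕ
stepCut v x = Closure.cut (closure (ψ v ++ x ∷ []))

ψ-step : ∀ v x → ψ (v ++ x ∷ []) ≡ (ψ v ++ x ∷ []) ++ reverse (take (stepCut v x) (ψ v ++ x ∷ []))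
ψ-step v x = trans (ψ-snoc v x) (Closure.closure≡ (closure (ψ v ++ x ∷ [])))

ψ-pal : ∀ v → Pal (ψ v)
ψ-pal = snoc-induction (λ v → Pal (ψ v)) refl λ v x _ →
  subst Pal (sym (ψ-step v x)) (close⁺ (stepCut v x) _ (Closure.palSuffix (closure (ψ v ++ x ∷ []))))

ψ-snoc-prefix : ∀ v x → ∃ λ s → ψ (v ++ x ∷ []) ≡ ψ v ++ x ∷ s
ψ-snoc-prefix v x = _ , trans (ψ-step v x) (++-assoc (ψ v) (x ∷ []) _)

mutual
  ψ-prefix : ∀ t u → ∃ λ s → ψ (u ++ t) ≡ ψ u ++ s
  ψ-prefix [] u = [] , trans (cong ψ (++-identityʳ u)) (sym (++-identityʳ (ψ u)))
  ψ-prefix (y ∷ t) u with ψ-prefix-letter u y t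
  ... | s , e = y ∷ s , e

  ψ-prefix-letter : ∀ u y t → ∃ λ s → ψ (u ++ y ∷ t) ≡ ψ u ++ y ∷ s
  ψ-prefix-letter u y t with ψ-snoc-prefix u y | ψ-prefix t (u ++ y ∷ [])
  ... | s₁ , e₁ | s₂ , e₂ = s₁ ++ s₂ , (begin
    ψ (u ++ y ∷ t)          ≡⟨ cong ψ (sym (++-assoc u (y ∷ []) t)) ⟩
    ψ ((u ++ y ∷ []) ++ t)  ≡⟨ e₂ ⟩
    ψ (u ++ y ∷ []) ++ s₂   ≡⟨ cong (_++ s₂) e₁ ⟩
    (ψ u ++ y ∷ s₁) ++ s₂   ≡⟨ ++-assoc (ψ u) (y ∷ s₁) s₂ ⟩
    ψ u ++ y ∷ s₁ ++ s₂     ∎)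
    where open ≡-Reasoning

length-0 : ∀ (s : Word) → length s ≡ 0 → s ≡ []
length-0 [] _ = refl

PalPrefixOfψ : Word → Word → Set
PalPrefixOfψ v P = ∃ λ u → ∃ λ t → u ++ t ≡ v × ψ u ≡ P

-- A
-- palindromic prefix of ψ(vx) longer than ψ(v) would yield a palindromic
-- suffix of ψ(v)x with a cut smaller than the one chosen by the closure.
palPrefix-ψ : ∀ v P s → Pal P → P ++ s ≡ ψ v → PalPrefixOfψ v P
palPrefix-ψ = snoc-induction (λ v → ∀ P s → Pal P → P ++ s ≡ ψ v → PalPrefixOfψ v P) base step
  where
  base : ∀ P s → Pal P → P ++ s ≡ [] → PalPrefixOfψ [] P
  base [] s _ _ = [] , [] , refl , refl
  base (_ ∷ _) s _ ()
  step : ∀ v x → (∀ P s → Pal P → P ++ s ≡ ψ v → PalPrefixOfψ v P) →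
         ∀ P s → Pal P → P ++ s ≡ ψ (v ++ x ∷ []) → PalPrefixOfψ (v ++ x ∷ []) P
  step v x ih P s pP e with ++-split P s (ψ v) (x ∷ proj₁ (ψ-snoc-prefix v x)) (trans e (proj₂ (ψ-snoc-prefix v x)))
  ... | inj₁ (r , e₁ , _) with ih P r pP (sym e₁)
  ...   | u , t , e₃ , e₄ = u , t ++ x ∷ [] , trans (sym (++-assoc u t _)) (cong (_++ x ∷ []) e₃) , e₄
  step v x ih P s pP e | inj₂ ([] , e₁ , _) = v , x ∷ [] , refl , trans (sym (++-identityʳ (ψ v))) (sym e₁)
  step v x ih P s pP e | inj₂ (x' ∷ r , e₁ , e₂) = v ++ x ∷ [] , [] , ++-identityʳ _ , sym P≡ψ
    where
    W = ψ v ++ x ∷ []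
    C = closure W
    j = Closure.cut C
    tail≡ : reverse (take j W) ≡ r ++ s
    tail≡ = trans (++-cancelˡ W _ _ (trans (sym (ψ-step v x))
              (trans (proj₂ (ψ-snoc-prefix v x)) (sym (++-assoc (ψ v) (x ∷ []) _))))) (∷-injectiveʳ e₂)
    P≡Wr : P ≡ W ++ r
    P≡Wr = trans e₁ (trans (cong (λ z → ψ v ++ z ∷ r) (sym (∷-injectiveˡ e₂))) (sym (++-assoc (ψ v) (x ∷ []) r)))
    |r|+|s| : length r + length s ≡ j
    |r|+|s| = trans (sym (length-++ r)) (trans (cong length (sym tail≡))
                (trans (length-reverse (take j W)) (length-take-≤ j W (Closure.cut≤ C))))
    |r|≤|W| : length r ≤ length W
    |r|≤|W| = ≤-trans (m≤m+n (length r) (length s)) (≤-trans (≤-reflexive |r|+|s|) (Closure.cut≤ C))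
    -- P is W closed at cut |r|, so the closure's cut j is at most |r|.
    j≤|r| : j ≤ length r
    j≤|r| with j ≤? length r
    ... | yes le = le
    ... | no nle = ⊥-elim (Closure.leastCut C (length r) (≰⇒> nle)
            (close⁻ (length r) W (subst Pal (trans P≡Wr (cong (W ++_) (pal-tail P W r pP P≡Wr |r|≤|W|))) pP)))
    s≡[] : s ≡ []
    s≡[] = length-0 s (+-cancelˡ-≡ (length r) (length s) 0
             (trans |r|+|s| (sym (trans (+-identityʳ _)
               (≤-antisym (≤-trans (m≤m+n (length r) (length s)) (≤-reflexive |r|+|s|)) j≤|r|)))))
    P≡ψ : P ≡ ψ (v ++ x ∷ [])
    P≡ψ = trans (sym (++-identityʳ P)) (trans (cong (P ++_) (sym s≡[])) e)

pal-ends⁻ : ∀ y (B : Word) x → Pal (y ∷ B ++ x ∷ []) → y ≡ x × Pal B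
pal-ends⁻ y B x p = y≡x , ∷ʳ-injectiveˡ (reverse B) B (∷-injectiveʳ (trans p' (cong (λ z → z ∷ B ++ x ∷ []) y≡x)))
  where
  p' : x ∷ reverse B ++ y ∷ [] ≡ y ∷ B ++ x ∷ []
  p' = trans (sym (reverse-ends y B x)) p
  y≡x : y ≡ x
  y≡x = sym (∷-injectiveˡ p')

pal-ends⁺ : ∀ x (B : Word) → Pal B → Pal (x ∷ B ++ x ∷ [])
pal-ends⁺ x B p = trans (reverse-ends x B x) (cong (λ z → x ∷ z ++ x ∷ []) p)

drop-mid : ∀ (A : Word) y B x → drop (length A) ((A ++ y ∷ B) ++ x ∷ []) ≡ y ∷ B ++ x ∷ []
drop-mid A y B x = trans (cong (drop (length A)) (++-assoc A (y ∷ B) (x ∷ []))) (drop-length-++ A _)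

∉-snoc : ∀ {x y : Letter} v → x ∉ v → ¬ x ≡ y → x ∉ v ++ y ∷ []
∉-snoc v x∉v x≢y x∈ with ∈-++⁻ v x∈
... | inj₁ x∈v = x∉v x∈v
... | inj₂ (here x≡y) = x≢y x≡y

pal-split : ∀ w A y B → Pal w → w ≡ A ++ y ∷ B → w ≡ reverse B ++ y ∷ reverse A
pal-split w A y B pw e = trans (sym pw) (trans (cong reverse e) (reverse-mid A y B))

palSuffix⇒occurrence : ∀ v x l → l < length (ψ v) → Pal (drop l (ψ v ++ x ∷ [])) →
  ∃ λ u → ∃ λ t → u ++ x ∷ t ≡ v × l + suc (length (ψ u)) ≡ length (ψ v)
palSuffix⇒occurrence v x l lt p with split-at (ψ v) l lt
... | A , y , B , e , refl with pal-ends⁻ y B x (subst Pal (trans (cong (λ z → drop (length A) (z ++ x ∷ [])) e) (drop-mid A y B x)) p)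
...   | refl , pB = occurrence (palPrefix-ψ v B (y ∷ reverse A) pB (sym ψv≡))
  where
  -- B is a palindromic prefix of ψ(v) …
  ψv≡ : ψ v ≡ B ++ y ∷ reverse A
  ψv≡ = trans (pal-split (ψ v) A y B (ψ-pal v) e) (cong (_++ y ∷ reverse A) pB)
  -- … hence B = ψ(u) for a proper prefix u of v, followed by the letter y.
  occurrence : PalPrefixOfψ v B → ∃ λ u → ∃ λ t → u ++ y ∷ t ≡ v × length A + suc (length (ψ u)) ≡ length (ψ v)
  occurrence (u , [] , e₃ , e₄) = ⊥-elim (<-irrefl refl (subst (λ z → length z < length (ψ v)) B≡ψv |B|<))
    where
    B≡ψv : B ≡ ψ v
    B≡ψv = trans (sym e₄) (cong ψ (trans (sym (++-identityʳ u)) e₃))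
    |B|< : length B < length (ψ v)
    |B|< = subst (length B <_) (trans (sym (length-++ B)) (cong length (sym ψv≡))) (m<m+n (length B) (s≤s z≤n))
  occurrence (u , y' ∷ t , e₃ , e₄) with ψ-prefix-letter u y' t
  ... | s , e₅ = u , t , trans (cong (λ z → u ++ z ∷ t) (sym y'≡y)) e₃ , |A|+|ψu|
    where
    y'≡y : y' ≡ y
    y'≡y = ∷-injectiveˡ (++-cancelˡ B _ _ (trans (sym (cong (_++ y' ∷ s) e₄)) (trans (sym e₅) (trans (cong ψ e₃) ψv≡))))
    |A|+|ψu| : length A + suc (length (ψ u)) ≡ length (ψ v)
    |A|+|ψu| = begin
      length A + suc (length (ψ u)) ≡⟨ cong (λ z → length A + suc (length z)) e₄ ⟩
      length A + suc (length B)     ≡⟨ sym (length-++ A) ⟩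
      length (A ++ y ∷ B)           ≡⟨ cong length (sym e) ⟩
      length (ψ v)                  ∎
      where open ≡-Reasoning

Gap : Word → Letter → ℕ → Set
Gap v x g = (x ∉ v × g ≡ suc (length (ψ v))) ⊎
  (∃ λ v₁ → ∃ λ v₂ → v ≡ v₁ ++ x ∷ v₂ × x ∉ v₂ × g + length (ψ v₁) ≡ length (ψ v))

ψ-step-length : ∀ v x → length (ψ (v ++ x ∷ [])) ≡ suc (length (ψ v)) + stepCut v x
ψ-step-length v x = begin
  length (ψ (v ++ x ∷ []))                ≡⟨ cong length (ψ-step v x) ⟩
  length (W ++ reverse (take j W))        ≡⟨ length-++ W ⟩
  length W + length (reverse (take j W))  ≡⟨ cong₂ _+_ (trans (length-++ (ψ v)) (+-comm (length (ψ v)) 1))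
                                               (trans (length-reverse (take j W)) (length-take-≤ j W (Closure.cut≤ (closure W)))) ⟩
  suc (length (ψ v)) + j                  ∎
  where
  open ≡-Reasoning
  W = ψ v ++ x ∷ []
  j = stepCut v x

-- If x does not occur in v, no proper suffix of ψ(v)x is a palindrome.
stepCut-absent : ∀ v x → x ∉ v → stepCut v x ≡ length (ψ v)
stepCut-absent v x x∉v = cut-unique (ψ v ++ x ∷ []) (length (ψ v))
  (subst Pal (sym (drop-length-++ (ψ v) (x ∷ []))) refl)
  λ l lt p → let (u , t , e , _) = palSuffix⇒occurrence v x l lt p in x∉v (subst (x ∈_) e (∈-insert u))

-- If v = v₁ x v₂ is the last occurrence of x and ψ(v) = ψ(v₁) x s, the
-- longest palindromic suffix of ψ(v)x is x ψ(v₁) x, at cut |s|.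
stepCut-last : ∀ v x v₁ v₂ s → v ≡ v₁ ++ x ∷ v₂ → x ∉ v₂ → ψ v ≡ ψ v₁ ++ x ∷ s → stepCut v x ≡ length s
stepCut-last v x v₁ v₂ s ev x∉v₂ eψ = cut-unique W (length s) palCut noSmaller
  where
  W = ψ v ++ x ∷ []
  |ψv| : length (ψ v) ≡ length (ψ v₁) + suc (length s)
  |ψv| = trans (cong length eψ) (length-++ (ψ v₁))
  palCut : Pal (drop (length s) W)
  palCut = subst Pal (sym (trans (cong (λ z → drop z W) (sym (length-reverse s)))
             (trans (cong (λ z → drop (length (reverse s)) (z ++ x ∷ [])) (pal-split (ψ v) (ψ v₁) x s (ψ-pal v) eψ))
               (trans (cong (λ z → drop (length (reverse s)) ((reverse s ++ x ∷ z) ++ x ∷ [])) (ψ-pal v₁))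
                 (drop-mid (reverse s) x (ψ v₁) x)))))
             (pal-ends⁺ x (ψ v₁) (ψ-pal v₁))
  -- A smaller cut would come from an occurrence v = u x t with |ψ(u)| > |ψ(v₁)|,
  -- i.e. an occurrence of x after v₁.
  noSmaller : ∀ l → l < length s → ¬ Pal (drop l W)
  noSmaller l lt pl with palSuffix⇒occurrence v x l
         (≤-trans lt (≤-trans (m≤n+m (length s) (length (ψ v₁))) (≤-trans (+-monoʳ-≤ (length (ψ v₁)) (n≤1+n _)) (≤-reflexive (sym |ψv|))))) pl
  ... | u , t , e , el = later (++-split u (x ∷ t) v₁ (x ∷ v₂) (trans e ev))
    where
    longer : ¬ (length (ψ u) ≤ length (ψ v₁))
    longer le = <-irrefl refl (subst (_< length (ψ v)) el
      (subst (l + suc (length (ψ u)) <_) (sym (trans |ψv| (trans (+-comm (length (ψ v₁)) _) (sym (+-suc (length s) _)))))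
        (+-mono-<-≤ lt (s≤s le))))
    later : _ → ⊥
    later (inj₁ (r , e₁ , _)) = longer (subst (λ z → length (ψ u) ≤ length z) (sym (trans (cong ψ e₁) (proj₂ (ψ-prefix r u))))
      (subst (length (ψ u) ≤_) (sym (length-++ (ψ u))) (m≤m+n _ _)))
    later (inj₂ ([] , e₁ , _)) = longer (≤-reflexive (cong (λ z → length (ψ z)) (trans e₁ (++-identityʳ v₁))))
    later (inj₂ (z ∷ r , _ , e₂)) = x∉v₂ (subst (x ∈_) (sym (∷-injectiveʳ e₂)) (∈-insert r))

gap-length : ∀ v v₁ x s g → ψ v ≡ ψ v₁ ++ x ∷ s → g + length (ψ v₁) ≡ length (ψ v) → g ≡ suc (length s)
gap-length v v₁ x s g eψ eg = +-cancelʳ-≡ (length (ψ v₁)) g (suc (length s))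
  (trans eg (trans (trans (cong length eψ) (length-++ (ψ v₁))) (+-comm (length (ψ v₁)) _)))

ψ-snoc-length : ∀ v x g → Gap v x g → length (ψ (v ++ x ∷ [])) ≡ length (ψ v) + g
ψ-snoc-length v x g (inj₁ (x∉v , refl)) = begin
  length (ψ (v ++ x ∷ []))         ≡⟨ ψ-step-length v x ⟩
  suc (length (ψ v)) + stepCut v x ≡⟨ cong (suc (length (ψ v)) +_) (stepCut-absent v x x∉v) ⟩
  suc (length (ψ v)) + length (ψ v) ≡⟨ +-comm (suc (length (ψ v))) _ ⟩
  length (ψ v) + suc (length (ψ v)) ∎
  where open ≡-Reasoning
ψ-snoc-length v x g (inj₂ (v₁ , v₂ , ev , x∉v₂ , eg)) with ψ-prefix-letter v₁ x v₂
... | s , eψ₀ = begin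
  length (ψ (v ++ x ∷ []))         ≡⟨ ψ-step-length v x ⟩
  suc (length (ψ v)) + stepCut v x ≡⟨ cong (suc (length (ψ v)) +_) (stepCut-last v x v₁ v₂ s ev x∉v₂ eψ) ⟩
  suc (length (ψ v)) + length s    ≡⟨ sym (+-suc (length (ψ v)) _) ⟩
  length (ψ v) + suc (length s)    ≡⟨ cong (length (ψ v) +_) (sym g≡) ⟩
  length (ψ v) + g                 ∎
  where
  open ≡-Reasoning
  eψ : ψ v ≡ ψ v₁ ++ x ∷ s
  eψ = trans (cong ψ ev) eψ₀
  g≡ : g ≡ suc (length s)
  g≡ = gap-length v v₁ x s g eψ eg

gap-same : ∀ v x g → Gap v x g → Gap (v ++ x ∷ []) x g
gap-same v x g gx = inj₂ (v , [] , refl , (λ ()) , trans (+-comm g _) (sym (ψ-snoc-length v x g gx)))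

gap-other : ∀ v x y g h → ¬ y ≡ x → Gap v x g → Gap v y h → Gap (v ++ x ∷ []) y (g + h)
gap-other v x y g h y≢x gx (inj₁ (y∉v , refl)) = inj₁ (∉-snoc v y∉v y≢x ,
  trans (+-suc g _) (cong suc (trans (+-comm g _) (sym (ψ-snoc-length v x g gx)))))
gap-other v x y g h y≢x gx (inj₂ (v₁ , v₂ , ev , y∉v₂ , eh)) = inj₂ (v₁ , v₂ ++ x ∷ [] ,
  trans (cong (_++ x ∷ []) ev) (++-assoc v₁ (y ∷ v₂) (x ∷ [])) , ∉-snoc v₂ y∉v₂ y≢x ,
  trans (+-assoc g h _) (trans (cong (g +_) eh) (trans (+-comm g _) (sym (ψ-snoc-length v x g gx)))))

pal-border-period : ∀ z q s → Pal z → Pal q → z ≡ q ++ s → Period (length s) z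
pal-border-period z q s pz pq e i lt = begin
  at z i                                ≡⟨ cong (λ w → at w i) e ⟩
  at (q ++ s) i                         ≡⟨ at-++ˡ q s i i<|q| ⟩
  at q i                                ≡⟨ sym (at-++ʳ (reverse s) q i) ⟩
  at (reverse s ++ q) (length (reverse s) + i) ≡⟨ cong (at (reverse s ++ q)) (trans (cong (_+ i) (length-reverse s)) (+-comm _ i)) ⟩
  at (reverse s ++ q) (i + length s)    ≡⟨ cong (λ w → at w (i + length s)) (sym z≡) ⟩
  at z (i + length s)                   ∎
  where
  open ≡-Reasoning
  z≡ : z ≡ reverse s ++ q
  z≡ = trans (sym pz) (trans (cong reverse e) (trans (reverse-++ q s) (cong (reverse s ++_) pq)))
  i<|q| : i < length q
  i<|q| = +-cancelʳ-< (length s) i (length q) (subst (i + length s <_) (trans (cong length e) (length-++ q)) lt)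

gap-period : ∀ v x g → Gap v x g → 1 ≤ g × Period g (ψ v)
gap-period v x g (inj₁ (_ , refl)) = s≤s z≤n , long-period _ (ψ v) (n≤1+n _)
gap-period v x g (inj₂ (v₁ , v₂ , ev , _ , eg)) with ψ-prefix-letter v₁ x v₂
... | s , eψ₀ = subst (1 ≤_) (sym g≡) (s≤s z≤n) ,
  subst (λ p → Period p (ψ v)) (sym g≡) (pal-border-period (ψ v) (ψ v₁) (x ∷ s) (ψ-pal v) (ψ-pal v₁) eψ)
  where
  eψ : ψ v ≡ ψ v₁ ++ x ∷ s
  eψ = trans (cong ψ ev) eψ₀
  g≡ : g ≡ suc (length s)
  g≡ = gap-length v v₁ x s g eψ eg

length-take-≤n : ∀ n (w : Word) → length (take n w) ≤ n
length-take-≤n n w = ≤-trans (≤-reflexive (length-take n w)) (m⊓n≤m n (length w))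

length-take-≤w : ∀ n (w : Word) → length (take n w) ≤ length w
length-take-≤w n w = ≤-trans (≤-reflexive (length-take n w)) (m⊓n≤n n (length w))

period-take : ∀ p n w → Period p w → Period p (take n w)
period-take p n w h i lt = trans (at-take n w i (<-≤-trans (≤-<-trans (m≤m+n i p) lt) (length-take-≤n n w)))
  (trans (h i (<-≤-trans lt (length-take-≤w n w))) (sym (at-take n w (i + p) (<-≤-trans lt (length-take-≤n n w)))))

period-iterate : ∀ d u → Period d u → ∀ k j → j + k * d < length u → at u j ≡ at u (j + k * d)
period-iterate d u h zero j lt = cong (at u) (sym (trans (cong (j +_) (*-zeroˡ d)) (+-identityʳ j)))
period-iterate d u h (suc k) j lt = trans (h j (≤-<-trans (+-monoʳ-≤ j (m≤m+n d (k * d))) lt))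
  (trans (period-iterate d u h k (j + d) (subst (_< length u) (sym (+-assoc j d (k * d))) lt))
    (cong (at u) (+-assoc j d (k * d))))

period-lift : ∀ p d t w → 1 ≤ p → Period p w → Period d (take t w) → p ≤ t → t ≤ length w → d ∣ p → Period d w
period-lift p d t w p≥1 hp hd p≤t t≤w (divides zero pe) = ⊥-elim (<-irrefl (sym pe) p≥1)
period-lift p d t w p≥1 hp hd p≤t t≤w (divides (suc k) pe) = <-rec _ lift
  where
  |u| : length (take t w) ≡ t
  |u| = length-take-≤ t w t≤w
  lift : ∀ i → (∀ {i'} → i' < i → i' + d < length w → at w i' ≡ at w (i' + d)) → i + d < length w → at w i ≡ at w (i + d)
  lift i rec lt with p ≤? i
  -- far from the start, shift back by the period p
  ... | yes p≤i = begin
    at w i             ≡⟨ cong (at w) (sym i'+p) ⟩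
    at w (i' + p)      ≡⟨ sym (hp i' (subst (_< length w) (sym i'+p) (≤-<-trans (m≤m+n i d) lt))) ⟩
    at w i'            ≡⟨ rec (subst (i' <_) i'+p (m<m+n i' p≥1)) (≤-<-trans (m≤m+n (i' + d) p) lt') ⟩
    at w (i' + d)      ≡⟨ hp (i' + d) lt' ⟩
    at w (i' + d + p)  ≡⟨ cong (at w) shift ⟩
    at w (i + d)       ∎
    where
    open ≡-Reasoning
    i' = i ∸ p
    i'+p : i' + p ≡ i
    i'+p = m∸n+n≡m p≤i
    shift : i' + d + p ≡ i + d
    shift = trans (+-right-comm i' d p) (cong (_+ d) i'+p)
    lt' : i' + d + p < length w
    lt' = subst (_< length w) (sym shift) lt
  ... | no p≰i with i + d <? t
  -- both positions inside the prefix
  ...   | yes inside = trans (sym (at-take t w i (≤-<-trans (m≤m+n i d) inside)))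
                         (trans (hd i (subst (i + d <_) (sym |u|) inside)) (at-take t w (i + d) inside))
  -- i < p ≤ i + d: with i + d = j + p and p = (k+1)·d, i = j + k·d
  ...   | no outside = begin
    at w i                   ≡⟨ sym (at-take t w i i<t) ⟩
    at (take t w) i          ≡⟨ cong (at (take t w)) (sym j+kd) ⟩
    at (take t w) (j + k * d) ≡⟨ sym (period-iterate d (take t w) hd k j (subst₂ _<_ (sym j+kd) (sym |u|) i<t)) ⟩
    at (take t w) j          ≡⟨ at-take t w j (≤-<-trans (subst (j ≤_) j+kd (m≤m+n j (k * d))) i<t) ⟩
    at w j                   ≡⟨ hp j (subst (_< length w) (sym j+p) lt) ⟩
    at w (j + p)             ≡⟨ cong (at w) j+p ⟩
    at w (i + d)             ∎
    where
    open ≡-Reasoning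
    i<t : i < t
    i<t = <-≤-trans (≰⇒> p≰i) p≤t
    j = i + d ∸ p
    j+p : j + p ≡ i + d
    j+p = m∸n+n≡m (≤-trans p≤t (≮⇒≥ outside))
    j+kd : j + k * d ≡ i
    j+kd = +-cancelʳ-≡ d _ _ (begin
      j + k * d + d   ≡⟨ +-assoc j (k * d) d ⟩
      j + (k * d + d) ≡⟨ cong (j +_) (+-comm (k * d) d) ⟩
      j + suc k * d   ≡⟨ cong (j +_) (sym pe) ⟩
      j + p           ≡⟨ j+p ⟩
      i + d           ∎)

period-difference : ∀ p q w → p < q → Period p w → Period q w → Period (q ∸ p) (take (length w ∸ p) w)
period-difference p q w p<q hp hq i lt = begin
  at u i                  ≡⟨ at-take n w i (<-≤-trans (≤-<-trans (m≤m+n i _) lt) (length-take-≤n n w)) ⟩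
  at w i                  ≡⟨ hq i (subst (_< length w) shift lt') ⟩
  at w (i + q)            ≡⟨ cong (at w) (sym shift) ⟩
  at w (i + (q ∸ p) + p)  ≡⟨ sym (hp (i + (q ∸ p)) lt') ⟩
  at w (i + (q ∸ p))      ≡⟨ sym (at-take n w (i + (q ∸ p)) (<-≤-trans lt (length-take-≤n n w))) ⟩
  at u (i + (q ∸ p))      ∎
  where
  open ≡-Reasoning
  n = length w ∸ p
  u = take n w
  shift : i + (q ∸ p) + p ≡ i + q
  shift = trans (+-assoc i _ p) (cong (i +_) (m∸n+n≡m (<⇒≤ p<q)))
  lt' : i + (q ∸ p) + p < length w
  lt' = <∸⇒+< (i + (q ∸ p)) (length w) p (<-≤-trans lt (length-take-≤n n w))

CommonPeriod : ℕ → ℕ → Word → Set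
CommonPeriod p q w = ∃ λ d → 1 ≤ d × d ∣ p × d ∣ q × Period d w

-- Euclid's algorithm on periods, with fuel f bounding p + q.
mutual
  fineWilf-fuel : ∀ f p q w → p + q ≤ f → 1 ≤ p → 1 ≤ q → Period p w → Period q w → p + q ≤ suc (length w) →
    CommonPeriod p q w
  fineWilf-fuel zero p q w le p≥1 q≥1 hp hq lw = ⊥-elim (<-irrefl refl (≤-trans (≤-trans p≥1 (m≤m+n p q)) le))
  fineWilf-fuel (suc f) p q w le p≥1 q≥1 hp hq lw with <-cmp p q
  ... | tri< lt _ _ = fineWilf-< f p q w lt le p≥1 hp hq lw
  ... | tri≈ _ refl _ = p , p≥1 , ∣-refl , ∣-refl , hp
  ... | tri> _ _ gt with fineWilf-< f q p w gt (subst (_≤ suc f) (+-comm p q) le) q≥1 hq hp (subst (_≤ suc (length w)) (+-comm p q) lw)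
  ...   | d , d≥1 , d∣q , d∣p , hd = d , d≥1 , d∣p , d∣q , hd

  fineWilf-< : ∀ f p q w → p < q → p + q ≤ suc f → 1 ≤ p → Period p w → Period q w → p + q ≤ suc (length w) →
    CommonPeriod p q w
  fineWilf-< f p q w p<q le p≥1 hp hq lw
    with fineWilf-fuel f p (q ∸ p) (take n w) le' p≥1 (m<n⇒0<n∸m p<q) (period-take p n w hp) (period-difference p q w p<q hp hq) lu
    where
    n = length w ∸ p
    p+[q∸p] : p + (q ∸ p) ≡ q
    p+[q∸p] = m+[n∸m]≡n (<⇒≤ p<q)
    le' : p + (q ∸ p) ≤ f
    le' = subst (_≤ f) (sym p+[q∸p]) (s≤s⁻¹ (≤-trans (+-monoˡ-≤ q p≥1) le))
    p≤w : p ≤ length w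
    p≤w = s≤s⁻¹ (≤-trans (subst (_≤ p + q) (+-comm p 1) (+-monoʳ-≤ p (≤-trans (s≤s z≤n) p<q))) lw)
    lu : p + (q ∸ p) ≤ suc (length (take n w))
    lu = subst₂ _≤_ (sym p+[q∸p]) (cong suc (sym (length-take-≤ n w (m∸n≤m (length w) p))))
           (subst (q ≤_) (+-∸-assoc 1 p≤w) (m+n≤o⇒m≤o∸n q (subst (_≤ suc (length w)) (+-comm p q) lw)))
  ... | d , d≥1 , d∣p , d∣q∸p , hd = d , d≥1 , d∣p , ∣m∸n∣n⇒∣m d (<⇒≤ p<q) d∣q∸p d∣p ,
       period-lift p d (length w ∸ p) w p≥1 hp hd p≤n (m∸n≤m (length w) p) d∣p
    where
    p≤n : p ≤ length w ∸ p
    p≤n = m+n≤o⇒m≤o∸n p (s≤s⁻¹ (≤-trans (subst (_≤ p + q) (+-suc p p) (+-monoʳ-≤ p p<q)) lw))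

fineWilf : ∀ p q w → 1 ≤ p → 1 ≤ q → Period p w → Period q w → p + q ≤ suc (length w) → CommonPeriod p q w
fineWilf p q w = fineWilf-fuel (p + q) p q w ≤-refl

-- The smaller of two coprime periods m < M with m + M = |w| + 2 is the
-- minimal period, unless w is constant: a period r < m would give, by two
-- rounds of Fine–Wilf, a common divisor of m and M that is a period.
small-period⇒period-1 : ∀ w m M r → 1 ≤ r → r < m → m < M → Period r w → Period m w → Period M w →
  m + M ≡ suc (suc (length w)) → Coprime m M → Period 1 w
small-period⇒period-1 w m M r r≥1 r<m m<M hr hm hM sum cop
  with fineWilf r M w r≥1 M≥1 hr hM (s≤s⁻¹ (≤-trans (+-monoˡ-≤ M r<m) (≤-reflexive sum)))
  where
  M≥1 : 1 ≤ M
  M≥1 = ≤-trans (s≤s z≤n) m<M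
... | d₁ , d₁≥1 , d₁∣r , d₁∣M , hd₁ with fineWilf d₁ m w d₁≥1 (≤-trans r≥1 (<⇒≤ r<m)) hd₁ hm d₁+m≤
  where
  d₁+m≤ : d₁ + m ≤ suc (length w)
  d₁+m≤ = s≤s⁻¹ (≤-trans (+-monoˡ-≤ m (<-trans (≤-<-trans (∣⇒≤ {{>-nonZero r≥1}} d₁∣r) r<m) m<M))
            (≤-reflexive (trans (+-comm M m) sum)))
...   | d₂ , _ , d₂∣d₁ , d₂∣m , hd₂ = subst (λ d → Period d w) (cop (d₂∣m , ∣-trans d₂∣d₁ d₁∣M)) hd₂

NonConstant : Word → Set
NonConstant w = ∃ λ i → i < length w × ¬ at w 0 ≡ at w i

period-1⇒constant : ∀ w → Period 1 w → ∀ i → i < length w → at w 0 ≡ at w i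
period-1⇒constant w h i lt = trans (period-iterate 1 w h i 0 (subst (_< length w) (sym (*-identityʳ i)) lt))
  (cong (at w) (*-identityʳ i))

π-lower-bound : ∀ w m M → Period m w → Period M w → 1 ≤ m → m < M → m + M ≡ suc (suc (length w)) →
  Coprime m M → NonConstant w → m ≤ π w
π-lower-bound w m M hm hM m≥1 m<M sum cop (i , i<w , w₀≢wᵢ) with m ≤? π w
... | yes le = le
... | no m≰π = ⊥-elim (w₀≢wᵢ (period-1⇒constant w
        (small-period⇒period-1 w m M (π w) (π-positive w) (≰⇒> m≰π) m<M (π-period w) hm hM sum cop) i i<w))

gapStep : ℕ × ℕ → Letter → ℕ × ℕ
gapStep (ga , gb) a = ga , ga + gb
gapStep (ga , gb) b = gb + ga , gb

gaps : Word → ℕ × ℕ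
gaps v = foldl gapStep (1 , 1) v

GapInvariant : Word → ℕ × ℕ → Set
GapInvariant v (ga , gb) = Gap v a ga × Gap v b gb × ga + gb ≡ suc (suc (length (ψ v))) × Coprime ga gb

gap-sum-step : ∀ v x g h → Gap v x g → g + h ≡ suc (suc (length (ψ v))) →
  g + (g + h) ≡ suc (suc (length (ψ (v ++ x ∷ []))))
gap-sum-step v x g h gx sum = begin
  g + (g + h)                    ≡⟨ cong (g +_) sum ⟩
  g + suc (suc (length (ψ v)))   ≡⟨ +-suc g _ ⟩
  suc (g + suc (length (ψ v)))   ≡⟨ cong suc (+-suc g _) ⟩
  suc (suc (g + length (ψ v)))   ≡⟨ cong (λ z → suc (suc z)) (+-comm g _) ⟩
  suc (suc (length (ψ v) + g))   ≡⟨ cong (λ z → suc (suc z)) (sym (ψ-snoc-length v x g gx)) ⟩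
  suc (suc (length (ψ (v ++ x ∷ [])))) ∎
  where open ≡-Reasoning

gapInvariant-step : ∀ v x s → GapInvariant v s → GapInvariant (v ++ x ∷ []) (gapStep s x)
gapInvariant-step v a (ga , gb) (gA , gB , sum , cop) =
  gap-same v a ga gA , gap-other v a b ga gb (λ ()) gA gB , gap-sum-step v a ga gb gA sum ,
  coprime-sym (coprime-+ (coprime-sym cop))
gapInvariant-step v b (ga , gb) (gA , gB , sum , cop) =
  gap-other v b a gb ga (λ ()) gB gA , gap-same v b gb gB ,
  trans (+-comm (gb + ga) gb) (gap-sum-step v b gb ga gB (trans (+-comm gb ga) sum)) ,
  coprime-+ cop

gapInvariant : ∀ v → GapInvariant v (gaps v)
gapInvariant = snoc-induction (λ v → GapInvariant v (gaps v)) (inj₁ ((λ ()) , refl) , inj₁ ((λ ()) , refl) , refl , 1-coprimeTo 1)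
  λ v x inv → subst (GapInvariant (v ++ x ∷ [])) (sym (foldl-∷ʳ gapStep (1 , 1) x v)) (gapInvariant-step v x (gaps v) inv)

-- The gap pair written with the gap m of the letter x (the last letter
-- read, whose gap is the smaller one) first.
ordered : Letter → ℕ → ℕ → ℕ × ℕ
ordered a m M = m , M
ordered b m M = M , m

gapStep-same : ∀ x m M → gapStep (ordered x m M) x ≡ ordered x m (m + M)
gapStep-same a m M = refl
gapStep-same b m M = refl

gapStep-switch : ∀ x m M → gapStep (ordered x m M) (swapL x) ≡ ordered (swapL x) M (m + M)
gapStep-switch a m M = cong (_, M) (+-comm M m)
gapStep-switch b m M = cong (M ,_) (+-comm M m)

same-or-switch : ∀ x y → y ≡ x ⊎ y ≡ swapL x
same-or-switch a a = inj₁ refl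
same-or-switch a b = inj₂ refl
same-or-switch b a = inj₂ refl
same-or-switch b b = inj₁ refl

swapL-≢ : ∀ x → ¬ swapL x ≡ x
swapL-≢ a ()
swapL-≢ b ()

fibIter : ℕ → ℕ → ℕ → ℕ
fibIter zero m M = m
fibIter (suc k) m M = fibIter k M (m + M)

fibIter-mono : ∀ k {m m' M M'} → m ≤ m' → M ≤ M' → fibIter k m M ≤ fibIter k m' M'
fibIter-mono zero le _ = le
fibIter-mono (suc k) le le' = fibIter-mono k le' (+-mono-≤ le le')

fibIter-strict : ∀ k {m m' M M'} → m < m' → M < M' → fibIter k m M < fibIter k m' M'
fibIter-strict zero lt _ = lt
fibIter-strict (suc k) lt lt' = fibIter-strict k lt' (+-mono-< lt lt')

fibIter-Fm1 : ∀ k j → fibIter k (Fm1 j) (Fm1 (suc j)) ≡ Fm1 (j + k)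
fibIter-Fm1 zero j = cong Fm1 (sym (+-identityʳ j))
fibIter-Fm1 (suc k) j = trans (cong (fibIter k (Fm1 (suc j))) (+-comm (Fm1 j) (Fm1 (suc j))))
  (trans (fibIter-Fm1 k (suc j)) (cong Fm1 (sym (+-suc j k))))

-- The continuations w of length k after the letter x that keep the smaller
-- gap maximal: alternate, possibly with the last two letters swapped.
Extremal : Letter → ℕ → Word → Set
Extremal x k w = w ≡ altFrom (swapL x) k ⊎ w ≡ c (altFrom (swapL x) k)

extremal-switch⁻ : ∀ x k v → Extremal x (suc k) (swapL x ∷ v) → Extremal (swapL x) k v
extremal-switch⁻ a k v (inj₁ e) = inj₁ (∷-injectiveʳ e)
extremal-switch⁻ b k v (inj₁ e) = inj₁ (∷-injectiveʳ e)
extremal-switch⁻ a zero v (inj₂ e) = inj₁ (∷-injectiveʳ e)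
extremal-switch⁻ b zero v (inj₂ e) = inj₁ (∷-injectiveʳ e)
extremal-switch⁻ a (suc zero) v (inj₂ ())
extremal-switch⁻ b (suc zero) v (inj₂ ())
extremal-switch⁻ a (suc (suc k)) v (inj₂ e) = inj₂ (∷-injectiveʳ e)
extremal-switch⁻ b (suc (suc k)) v (inj₂ e) = inj₂ (∷-injectiveʳ e)

extremal-switch⁺ : ∀ x k v → Extremal (swapL x) k v → Extremal x (suc k) (swapL x ∷ v)
extremal-switch⁺ a k v (inj₁ e) = inj₁ (cong (b ∷_) e)
extremal-switch⁺ b k v (inj₁ e) = inj₁ (cong (a ∷_) e)
extremal-switch⁺ a zero v (inj₂ e) = inj₁ (cong (b ∷_) e)
extremal-switch⁺ b zero v (inj₂ e) = inj₁ (cong (a ∷_) e)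
extremal-switch⁺ a (suc zero) v (inj₂ e) = inj₁ (cong (b ∷_) e)
extremal-switch⁺ b (suc zero) v (inj₂ e) = inj₁ (cong (a ∷_) e)
extremal-switch⁺ a (suc (suc k)) v (inj₂ e) = inj₂ (cong (b ∷_) e)
extremal-switch⁺ b (suc (suc k)) v (inj₂ e) = inj₂ (cong (a ∷_) e)

extremal-repeat : ∀ x k v → Extremal x (suc k) (x ∷ v) → v ≡ swapL x ∷ []
extremal-repeat a k v (inj₁ ())
extremal-repeat b k v (inj₁ ())
extremal-repeat a zero v (inj₂ ())
extremal-repeat b zero v (inj₂ ())
extremal-repeat a (suc zero) v (inj₂ e) = ∷-injectiveʳ e
extremal-repeat b (suc zero) v (inj₂ e) = ∷-injectiveʳ e
extremal-repeat a (suc (suc k)) v (inj₂ ())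
extremal-repeat b (suc (suc k)) v (inj₂ ())

extremal-pair : ∀ x → Extremal x 2 (x ∷ swapL x ∷ [])
extremal-pair a = inj₂ refl
extremal-pair b = inj₂ refl

extremal-one : ∀ x → Extremal x 1 (swapL x ∷ [])
extremal-one a = inj₁ refl
extremal-one b = inj₁ refl

extremal-single : ∀ x v → Extremal x 1 v → v ≡ swapL x ∷ []
extremal-single a v (inj₁ e) = e
extremal-single a v (inj₂ e) = e
extremal-single b v (inj₁ e) = e
extremal-single b v (inj₂ e) = e

record SmallGapBound (v : Word) (x : Letter) (m M : ℕ) : Set where
  field
    last      : Letter
    small     : ℕ
    large     : ℕ
    run≡      : foldl gapStep (ordered x m M) v ≡ ordered last small large
    small≥1   : 1 ≤ small
    small<    : small < large
    small≤    : small ≤ fibIter (length v) m M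
    optimal⇒  : small ≡ fibIter (length v) m M → Extremal x (length v) v
    ⇒optimal  : Extremal x (length v) v → small ≡ fibIter (length v) m M

smallGapBound : ∀ v x m M → 1 ≤ m → m < M → SmallGapBound v x m M
smallGapBound [] x m M m≥1 m<M = record { last = x ; small = m ; large = M ; run≡ = refl ; small≥1 = m≥1 ;
  small< = m<M ; small≤ = ≤-refl ; optimal⇒ = λ _ → inj₁ refl ; ⇒optimal = λ _ → refl }
smallGapBound (y ∷ v) x m M m≥1 m<M with same-or-switch x y
-- switching letters: exactly the recursion of fibIter
... | inj₂ refl = record { last = last ; small = small ; large = large ;
      run≡ = trans (cong (λ s → foldl gapStep s v) (gapStep-switch x m M)) run≡ ; small≥1 = small≥1 ; small< = small< ;
      small≤ = small≤ ; optimal⇒ = λ e → extremal-switch⁺ x (length v) v (optimal⇒ e) ;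
      ⇒optimal = λ e → ⇒optimal (extremal-switch⁻ x (length v) v e) }
  where
  open SmallGapBound (smallGapBound v (swapL x) M (m + M) (≤-trans m≥1 (<⇒≤ m<M)) (m<n+m M m≥1))
-- repeating the letter: never better, and as good only for the ending x (swapL x)
... | inj₁ refl = record { last = last ; small = small ; large = large ;
      run≡ = trans (cong (λ s → foldl gapStep s v) (gapStep-same x m M)) run≡ ; small≥1 = small≥1 ; small< = small< ;
      small≤ = ≤-trans small≤ (fibIter-mono (length v) (<⇒≤ m<M) ≤-refl) ; optimal⇒ = repeat-optimal⇒extremal v small≤ optimal⇒ ;
      ⇒optimal = λ e → repeat-extremal⇒optimal v e ⇒optimal }
  where
  open SmallGapBound (smallGapBound v x m (m + M) m≥1 (m<m+n m (≤-trans m≥1 (<⇒≤ m<M))))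
  repeat-loses : ∀ v → ¬ length v ≡ 1 → fibIter (length v) m (m + M) < fibIter (length v) M (m + M)
  repeat-loses [] _ = m<M
  repeat-loses (_ ∷ []) n = ⊥-elim (n refl)
  repeat-loses (_ ∷ _ ∷ v) _ =
    fibIter-strict (length v) (+-monoˡ-< (m + M) m<M) (+-monoʳ-< (m + M) (+-monoˡ-< (m + M) m<M))
  repeat-optimal⇒extremal : ∀ v → small ≤ fibIter (length v) m (m + M) →
    (small ≡ fibIter (length v) m (m + M) → Extremal x (length v) v) →
    small ≡ fibIter (length v) M (m + M) → Extremal x (suc (length v)) (x ∷ v)
  repeat-optimal⇒extremal [] le _ e = ⊥-elim (<-irrefl e (≤-<-trans le (repeat-loses [] (λ ()))))
  repeat-optimal⇒extremal (y ∷ []) le opt e with extremal-single x (y ∷ []) (opt e)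
  ... | refl = extremal-pair x
  repeat-optimal⇒extremal (y₁ ∷ y₂ ∷ v) le _ e = ⊥-elim (<-irrefl e (≤-<-trans le (repeat-loses (y₁ ∷ y₂ ∷ v) (λ ()))))
  repeat-extremal⇒optimal : ∀ v → Extremal x (suc (length v)) (x ∷ v) →
    (Extremal x (length v) v → small ≡ fibIter (length v) m (m + M)) → small ≡ fibIter (length v) M (m + M)
  repeat-extremal⇒optimal v e opt with extremal-repeat x (length v) v e
  ... | refl = opt (extremal-one x)

record GapPeriods (w : Word) (m M : ℕ) : Set where
  field
    period-m : Period m w
    period-M : Period M w
    m≥1      : 1 ≤ m
    sum      : m + M ≡ suc (suc (length w))
    coprime  : Coprime m M

gapPeriods : ∀ v z m M → GapInvariant v (ordered z m M) → GapPeriods (ψ v) m M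
gapPeriods v a m M (gA , gB , sum , cop) = record { period-m = proj₂ (gap-period v a m gA) ;
  period-M = proj₂ (gap-period v b M gB) ; m≥1 = proj₁ (gap-period v a m gA) ; sum = sum ; coprime = cop }
gapPeriods v b m M (gA , gB , sum , cop) = record { period-m = proj₂ (gap-period v b m gB) ;
  period-M = proj₂ (gap-period v a M gA) ; m≥1 = proj₁ (gap-period v b m gB) ; sum = trans (+-comm m M) sum ;
  coprime = coprime-sym cop }

gaps-cons : ∀ x v → gaps (x ∷ v) ≡ foldl gapStep (ordered x 1 2) v
gaps-cons a v = refl
gaps-cons b v = refl

ψ-single : ∀ x → ψ (x ∷ []) ≡ x ∷ []
ψ-single a = refl
ψ-single b = refl

-- ψ(x u (swapL x) t) starts with x and has swapL x at position |ψ(x u)|.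
nonConstant-ψ : ∀ x u t → NonConstant (ψ (x ∷ u ++ swapL x ∷ t))
nonConstant-ψ x u t with ψ-prefix-letter (x ∷ u) (swapL x) t | ψ-prefix u (x ∷ [])
... | s , eψ | s₂ , eψu = length (ψ (x ∷ u)) , |ψxu|< , λ h → swapL-≢ x (sym (just-injective (trans (sym first) (trans h later))))
  where
  ψxu≡ : ψ (x ∷ u) ≡ x ∷ s₂
  ψxu≡ = trans eψu (cong (_++ s₂) (ψ-single x))
  |ψxu|< : length (ψ (x ∷ u)) < length (ψ (x ∷ u ++ swapL x ∷ t))
  |ψxu|< = subst (length (ψ (x ∷ u)) <_) (trans (sym (length-++ (ψ (x ∷ u)))) (cong length (sym eψ))) (m<m+n _ (s≤s z≤n))
  first : at (ψ (x ∷ u ++ swapL x ∷ t)) 0 ≡ just x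
  first = cong (λ w → at w 0) (trans eψ (cong (_++ swapL x ∷ s) ψxu≡))
  later : at (ψ (x ∷ u ++ swapL x ∷ t)) (length (ψ (x ∷ u))) ≡ just (swapL x)
  later = trans (cong (λ w → at w (length (ψ (x ∷ u)))) eψ)
    (trans (cong (at (ψ (x ∷ u) ++ swapL x ∷ s)) (sym (+-identityʳ _))) (at-++ʳ (ψ (x ∷ u)) (swapL x ∷ s) 0))

extremal-occurrence : ∀ x k v → Extremal x (suc k) v → ∃ λ u → ∃ λ t → v ≡ u ++ swapL x ∷ t
extremal-occurrence a k v (inj₁ e) = [] , _ , e
extremal-occurrence b k v (inj₁ e) = [] , _ , e
extremal-occurrence a zero v (inj₂ e) = [] , _ , e
extremal-occurrence b zero v (inj₂ e) = [] , _ , e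
extremal-occurrence a (suc zero) v (inj₂ e) = a ∷ [] , [] , e
extremal-occurrence b (suc zero) v (inj₂ e) = b ∷ [] , [] , e
extremal-occurrence a (suc (suc k)) v (inj₂ e) = [] , _ , e
extremal-occurrence b (suc (suc k)) v (inj₂ e) = [] , _ , e

module FirstLetter (x : Letter) (v' : Word) where
  open SmallGapBound (smallGapBound v' x 1 2 (s≤s z≤n) (s≤s (s≤s z≤n)))

  periods : GapPeriods (ψ (x ∷ v')) small large
  periods = gapPeriods (x ∷ v') last small large
    (subst (GapInvariant (x ∷ v')) (trans (gaps-cons x v') run≡) (gapInvariant (x ∷ v')))
  open GapPeriods periods

  fibIter≡F : fibIter (length v') 1 2 ≡ Fm1 (suc (length v'))
  fibIter≡F = fibIter-Fm1 (length v') 1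

  π≤small : π (ψ (x ∷ v')) ≤ small
  π≤small = π-least (ψ (x ∷ v')) small m≥1 period-m

  π≤F : π (ψ (x ∷ v')) ≤ Fm1 (suc (length v'))
  π≤F = ≤-trans π≤small (subst (small ≤_) fibIter≡F small≤)

  π≡F⇒extremal : π (ψ (x ∷ v')) ≡ Fm1 (suc (length v')) → Extremal x (length v') v'
  π≡F⇒extremal e = optimal⇒ (≤-antisym small≤ (≤-trans (≤-reflexive (trans fibIter≡F (sym e))) π≤small))

  small≤π : NonConstant (ψ (x ∷ v')) → small ≤ π (ψ (x ∷ v'))
  small≤π = π-lower-bound (ψ (x ∷ v')) small large period-m period-M m≥1 small< sum coprime

  extremal⇒F≤π : Extremal x (length v') v' → NonConstant (ψ (x ∷ v')) → Fm1 (suc (length v')) ≤ π (ψ (x ∷ v'))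
  extremal⇒F≤π ext nc = subst (_≤ π (ψ (x ∷ v'))) (trans (⇒optimal ext) fibIter≡F) (small≤π nc)

open FirstLetter using (π≤F; π≡F⇒extremal; extremal⇒F≤π)

-- Extremal continuations reach F_{n-1}: either the word has one letter, or
-- it contains both letters and the lower bound applies.
extremal⇒π≡F : ∀ x v' → Extremal x (length v') v' → π (ψ (x ∷ v')) ≡ Fm1 (suc (length v'))
extremal⇒π≡F x [] _ = cong π (ψ-single x)
extremal⇒π≡F x (y ∷ v') ext with extremal-occurrence x (length v') (y ∷ v') ext
... | u , t , e = ≤-antisym (π≤F x (y ∷ v'))
  (extremal⇒F≤π x (y ∷ v') ext (subst (λ w → NonConstant (ψ (x ∷ w))) (sym e) (nonConstant-ψ x u t)))

MaxWord : ℕ → Word → Set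
MaxWord n v = v ≡ vpow n ⊎ v ≡ E (vpow n) ⊎ v ≡ c (vpow n) ⊎ v ≡ E (c (vpow n))

E-alt : ∀ x n → E (altFrom x n) ≡ altFrom (swapL x) n
E-alt x zero = refl
E-alt a (suc n) = cong (b ∷_) (E-alt b n)
E-alt b (suc n) = cong (a ∷_) (E-alt a n)

E-c : ∀ w → E (c w) ≡ c (E w)
E-c [] = refl
E-c (x ∷ []) = refl
E-c (x ∷ y ∷ []) = refl
E-c (x ∷ y ∷ z ∷ w) = cong (swapL x ∷_) (E-c (y ∷ z ∷ w))

E-c-alt : ∀ x n → E (c (altFrom x n)) ≡ c (altFrom (swapL x) n)
E-c-alt x n = trans (E-c (altFrom x n)) (cong c (E-alt x n))

length-alt : ∀ x n → length (altFrom x n) ≡ n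
length-alt x zero = refl
length-alt a (suc n) = cong suc (length-alt b n)
length-alt b (suc n) = cong suc (length-alt a n)

extremal⇒maxWord : ∀ x k v → Extremal x k v → MaxWord (suc k) (x ∷ v)
extremal⇒maxWord a k v (inj₁ e) = inj₁ (cong (a ∷_) e)
extremal⇒maxWord b k v (inj₁ e) = inj₂ (inj₁ (cong (b ∷_) (trans e (sym (E-alt b k)))))
extremal⇒maxWord a zero v (inj₂ e) = inj₁ (cong (a ∷_) e)
extremal⇒maxWord a (suc zero) v (inj₂ e) = inj₁ (cong (a ∷_) e)
extremal⇒maxWord a (suc (suc k)) v (inj₂ e) = inj₂ (inj₂ (inj₁ (cong (a ∷_) e)))
extremal⇒maxWord b zero v (inj₂ e) = inj₂ (inj₁ (cong (b ∷_) e))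
extremal⇒maxWord b (suc zero) v (inj₂ e) = inj₂ (inj₁ (cong (b ∷_) e))
extremal⇒maxWord b (suc (suc k)) v (inj₂ e) = inj₂ (inj₂ (inj₂ (cong (b ∷_) (trans e (sym (E-c-alt b (suc (suc k))))))))

maxWord⇒extremal : ∀ x k v → MaxWord (suc k) (x ∷ v) → Extremal x k v
maxWord⇒extremal .a k .(altFrom b k) (inj₁ refl) = inj₁ refl
maxWord⇒extremal .b k .(E (altFrom b k)) (inj₂ (inj₁ refl)) = inj₁ (E-alt b k)
maxWord⇒extremal x zero v (inj₂ (inj₂ (inj₁ refl))) = inj₁ refl
maxWord⇒extremal x (suc zero) v (inj₂ (inj₂ (inj₁ refl))) = inj₁ refl
maxWord⇒extremal x (suc (suc k)) v (inj₂ (inj₂ (inj₁ refl))) = inj₂ refl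
maxWord⇒extremal x zero v (inj₂ (inj₂ (inj₂ refl))) = inj₁ refl
maxWord⇒extremal x (suc zero) v (inj₂ (inj₂ (inj₂ refl))) = inj₁ refl
maxWord⇒extremal x (suc (suc k)) v (inj₂ (inj₂ (inj₂ refl))) = inj₂ (E-c-alt b (suc (suc k)))

π-bound : ∀ v → π (ψ v) ≤ Fm1 (length v)
π-bound [] = ≤-refl
π-bound (x ∷ v') = π≤F x v'

π-max⇔ : ∀ v → (π (ψ v) ≡ Fm1 (length v)) ⇔ MaxWord (length v) v
π-max⇔ [] = mk⇔ (λ _ → inj₁ refl) (λ _ → refl)
π-max⇔ (x ∷ v') = mk⇔ (λ e → extremal⇒maxWord x (length v') v' (π≡F⇒extremal x v' e))
                      (λ m → extremal⇒π≡F x v' (maxWord⇒extremal x (length v') v' m))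

vpow-max : ∀ n → π (ψ (vpow n)) ≡ Fm1 n
vpow-max n = subst (λ k → π (ψ (vpow n)) ≡ Fm1 k) (length-alt a n)
  (Equivalence.from (π-max⇔ (vpow n)) (inj₁ (cong vpow (sym (length-alt a n)))))

theorem4p5 : (n : ℕ) (v : Word) → length v ≡ n →
    (π (ψ v) ≤ π (ψ (vpow n)))
    × (π (ψ (vpow n)) ≡ Fm1 n)
    × ((π (ψ v) ≡ Fm1 n) ⇔
        (v ≡ vpow n ⊎ v ≡ E (vpow n) ⊎ v ≡ c (vpow n) ⊎ v ≡ E (c (vpow n))))
theorem4p5 .(length v) v refl =
  ≤-trans (π-bound v) (≤-reflexive (sym (vpow-max (length v)))) , vpow-max (length v) , π-max⇔ v
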